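{- Let $D$ be a directed graph with strong diameter $2$ and let $r$ be a root. Then in any configuration of pebbles on $D$ that is not $r$-solvable, no vertex has more than $3$ pebbles.
   Context: Directed graphs are loopless and may contain opposite arc pairs. Strong diameter $2$: for every ordered pair of distinct vertices $(i,j)$ there is a directed path from $i$ to $j$ of length at most $2$. A configuration is a function $C:V(D)\to\mathbb{N}$. A pebbling move along an arc $i\to j$ removes two pebbles from $i$ and adds one pebble to $j$. A configuration is $r$-solvable if some sequence (possibly empty) of pebbling moves places a pebble on $r$. -}

module Defs where

open import Data.Nat using (ℕ; suc; _+_; _≤_)
open import Data.Fin using (Fin)
open import Data.Fin.Properties using (_≟_)
open import Data.Product using (Σ; _×_; ∃-syntax)
open import Data.Sum using (_⊎_)
open import Data.Empty using (⊥)
open import Relation.Nullary using (¬_; yes; no)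
open import Relation.Binary.PropositionalEquality using (_≡_)

record Digraph (n : ℕ) : Set₁ where
  field
    Arc      : Fin n → Fin n → Set
    loopless : ∀ i → ¬ Arc i i
open Digraph public

StrongDiam2 : ∀ {n} → Digraph n → Set
StrongDiam2 {n} D =
  ∀ (i j : Fin n) → ¬ i ≡ j →
    Arc D i j ⊎ (∃[ k ] (Arc D i k × Arc D k j))

Config : ℕ → Set
Config n = Fin n → ℕ

record Move {n} (D : Digraph n) (C C' : Config n) : Set where
  field
    from to : Fin n
    arc     : Arc D from to
    atFrom  : C from ≡ C' from + 2
    atTo    : C' to ≡ C to + 1
    others  : ∀ v → ¬ v ≡ from → ¬ v ≡ to → C' v ≡ C v

data Reach {n} (D : Digraph n) : Config n → Config n → Set where
  done : ∀ {C} → Reach D C C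
  step : ∀ {C C' C''} → Move D C C' → Reach D C' C'' → Reach D C C''

Solvable : ∀ {n} → Digraph n → Config n → Fin n → Set
Solvable D C r = ∃[ C' ] (Reach D C C' × 1 ≤ C' r)

-- A vertex v with at least four pebbles can always reach the root r: if v = r
-- there is nothing to do; if v → r is an arc, one move suffices; otherwise
-- strong diameter 2 gives a path v → k → r, and two moves along v → k put
-- two pebbles on k, which then move one pebble to r.
module Submission where

open import Defs
open import Data.Nat using (_≤_; _+_; _∸_; z≤n; s≤s; _≤?_)
open import Data.Nat.Properties using (m∸n+n≡m; ≰⇒>; m≤n+m; ≤-trans; +-monoˡ-≤; ∸-monoˡ-≤)
open import Data.Fin using (Fin)
open import Data.Fin.Properties using (_≟_)
open import Data.Product using (_,_)
open import Data.Sum using (inj₁; inj₂)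
open import Relation.Nullary using (¬_; yes; no; contradiction)
open import Relation.Binary.PropositionalEquality using (_≡_; refl; sym; trans; cong; subst)

arc⇒≢ : ∀ {n} (D : Digraph n) {i j : Fin n} → Arc D i j → ¬ i ≡ j
arc⇒≢ D {i} a refl = loopless D i a

-- Truncated at i: this is the result of a move only when 2 ≤ C i (see move).
afterMove : ∀ {n} → Fin n → Fin n → Config n → Config n
afterMove i j C w with w ≟ i
... | yes _ = C i ∸ 2
... | no _ with w ≟ j
...   | yes _ = C j + 1
...   | no _  = C w

afterMove-from : ∀ {n} (i j : Fin n) C → afterMove i j C i ≡ C i ∸ 2
afterMove-from i j C with i ≟ i
... | yes _   = refl
... | no i≢i = contradiction refl i≢i

afterMove-to : ∀ {n} (i j : Fin n) C → ¬ i ≡ j → afterMove i j C j ≡ C j + 1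
afterMove-to i j C i≢j with j ≟ i
... | yes j≡i = contradiction (sym j≡i) i≢j
... | no _ with j ≟ j
...   | yes _   = refl
...   | no j≢j = contradiction refl j≢j

afterMove-other : ∀ {n} (i j : Fin n) C v → ¬ v ≡ i → ¬ v ≡ j → afterMove i j C v ≡ C v
afterMove-other i j C v v≢i v≢j with v ≟ i
... | yes v≡i = contradiction v≡i v≢i
... | no _ with v ≟ j
...   | yes v≡j = contradiction v≡j v≢j
...   | no _    = refl

move : ∀ {n} (D : Digraph n) {i j : Fin n} (C : Config n) →
  Arc D i j → 2 ≤ C i → Move D C (afterMove i j C)
move D {i} {j} C a 2≤Ci = record
  { from   = i
  ; to     = j
  ; arc    = a
  ; atFrom = trans (sym (m∸n+n≡m 2≤Ci)) (cong (_+ 2) (sym (afterMove-from i j C)))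
  ; atTo   = afterMove-to i j C (arc⇒≢ D a)
  ; others = afterMove-other i j C
  }

solvable-here : ∀ {n} (D : Digraph n) (C : Config n) {r : Fin n} → 1 ≤ C r → Solvable D C r
solvable-here D C 1≤Cr = C , done , 1≤Cr

solvable-step : ∀ {n} {D : Digraph n} {C C' : Config n} {r : Fin n} →
  Move D C C' → Solvable D C' r → Solvable D C r
solvable-step m (C'' , reach , 1≤C''r) = C'' , step m reach , 1≤C''r

solvable-arc : ∀ {n} (D : Digraph n) (C : Config n) {i r : Fin n} →
  Arc D i r → 2 ≤ C i → Solvable D C r
solvable-arc D C {i} {r} a 2≤Ci =
  solvable-step (move D C a 2≤Ci)
    (solvable-here D _ (subst (1 ≤_) (sym (afterMove-to i r C (arc⇒≢ D a))) (m≤n+m 1 (C r))))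

solvable-path2 : ∀ {n} (D : Digraph n) (C : Config n) {i k r : Fin n} →
  Arc D i k → Arc D k r → 4 ≤ C i → Solvable D C r
solvable-path2 D C {i} {k} a b 4≤Ci =
  solvable-step (move D C a 2≤Ci) (solvable-step (move D C₁ a 2≤C₁i) (solvable-arc D C₂ b 2≤C₂k))
  where
  i≢k : ¬ i ≡ k
  i≢k = arc⇒≢ D a
  C₁ C₂ : Config _
  C₁ = afterMove i k C
  C₂ = afterMove i k C₁
  2≤Ci : 2 ≤ C i
  2≤Ci = ≤-trans (s≤s (s≤s z≤n)) 4≤Ci
  2≤C₁i : 2 ≤ C₁ i
  2≤C₁i = subst (2 ≤_) (sym (afterMove-from i k C)) (∸-monoˡ-≤ 2 4≤Ci)
  2≤C₂k : 2 ≤ C₂ k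
  2≤C₂k = subst (2 ≤_) (sym (trans (afterMove-to i k C₁ i≢k) (cong (_+ 1) (afterMove-to i k C i≢k))))
                (+-monoˡ-≤ 1 (m≤n+m 1 (C k)))

solvable-from-4 : ∀ {n} (D : Digraph n) → StrongDiam2 D → (r : Fin n) →
  (C : Config n) (v : Fin n) → 4 ≤ C v → Solvable D C r
solvable-from-4 D diam r C v 4≤Cv with v ≟ r
... | yes refl = solvable-here D C (≤-trans (s≤s z≤n) 4≤Cv)
... | no v≢r with diam v r v≢r
...   | inj₁ a           = solvable-arc D C a (≤-trans (s≤s (s≤s z≤n)) 4≤Cv)
...   | inj₂ (k , a , b) = solvable-path2 D C a b 4≤Cv

proposition1 : ∀ {n} (D : Digraph n) → StrongDiam2 D → (r : Fin n) →
    (C : Config n) → ¬ Solvable D C r → ∀ (v : Fin n) → C v ≤ 3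
proposition1 D diam r C unsolvable v with C v ≤? 3
... | yes Cv≤3 = Cv≤3
... | no Cv≰3  = contradiction (solvable-from-4 D diam r C v (≰⇒> Cv≰3)) unsolvable
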